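{- Let $F$ be a graph of diameter $2$ with $n=|V(F)|$, and let $l>n$ be an integer. Let $A_{2l-1}$ be the graph with vertex set $\{1,2,\dots,2l-1\}$ in which distinct vertices $i,j$ are adjacent if and only if $|i-j|\le l-1$. For each vertex $i$ let $z_i$ denote the $F$-degree of $i$ in $A_{2l-1}$. Then $z_{i+1}\ge z_i+C_{l-2}^{n-2}$ for every $i\in\{1,2,\dots,l-1\}$.
   Context: All graphs are finite, simple and undirected. For graphs $F$ and $G$ and a vertex $v$ of $G$, the $F$-degree of $v$ in $G$ is the number of subgraphs of $G$ (not necessarily induced) that are isomorphic to $F$ and contain $v$. $C_m^k$ denotes the binomial coefficient $\frac{m!}{k!(m-k)!}$ for integers $m\ge k\ge 0$, and $C_m^k=0$ otherwise. -}

module Defs where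

open import Data.Bool using (Bool; true; false; _∧_; _∨_; not; if_then_else_)
open import Data.Nat using (ℕ; zero; suc; _∸_; _≡ᵇ_; _≤ᵇ_; ∣_-_∣)
open import Data.Nat.Properties using (∣-∣-comm)
open import Data.Fin using (Fin; toℕ)
open import Data.List using (List; []; _∷_; map; concatMap; filter; length; allFin; cartesianProduct)
open import Data.Bool.ListAction using (any; all)
open import Data.Vec using (Vec; []; _∷_; lookup)
open import Data.Product using (Σ; ∃; _×_; _,_; proj₁; proj₂)
open import Data.Sum using (_⊎_)
open import Relation.Nullary using (¬_)
open import Relation.Binary.PropositionalEquality using (_≡_; refl; cong; cong₂)

record Graph (n : ℕ) : Set where
  field
    adj    : Fin n → Fin n → Bool
    sym    : ∀ i j → adj i j ≡ adj j i
    irrefl : ∀ i → adj i i ≡ false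
open Graph public

data Walk {n : ℕ} (G : Graph n) : Fin n → Fin n → ℕ → Set where
  here : ∀ u → Walk G u u 0
  step : ∀ {u w v k} → adj G u w ≡ true → Walk G w v k → Walk G u (v) (suc k)

DistLe : {n : ℕ} → Graph n → Fin n → Fin n → ℕ → Set
DistLe G u v k = Σ ℕ λ j → (j Data.Nat.≤ k) × Walk G u v j

Diameter2 : {n : ℕ} → Graph n → Set
Diameter2 {n} G =
  (∀ u v → DistLe G u v 2) × (Σ (Fin n) λ u → Σ (Fin n) λ v → ¬ DistLe G u v 1)

-- The graph A_{2l-1}: vertex index k : Fin (2l-1) stands for the
-- vertex k+1 of {1,…,2l-1}; distinct i,j adjacent iff |i-j| ≤ l-1.

private
  ≡ᵇ-refl : ∀ m → (m ≡ᵇ m) ≡ true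
  ≡ᵇ-refl zero = refl
  ≡ᵇ-refl (suc m) = ≡ᵇ-refl m

  ≡ᵇ-sym : ∀ m k → (m ≡ᵇ k) ≡ (k ≡ᵇ m)
  ≡ᵇ-sym zero zero = refl
  ≡ᵇ-sym zero (suc k) = refl
  ≡ᵇ-sym (suc m) zero = refl
  ≡ᵇ-sym (suc m) (suc k) = ≡ᵇ-sym m k

A : (l : ℕ) → Graph (2 Data.Nat.* l ∸ 1)
A l = record
  { adj    = λ i j → not (toℕ i ≡ᵇ toℕ j) ∧ (∣ toℕ i - toℕ j ∣ ≤ᵇ l ∸ 1)
  ; sym    = λ i j → cong₂ (λ a b → not a ∧ (b ≤ᵇ l ∸ 1))
                       (≡ᵇ-sym (toℕ i) (toℕ j)) (∣-∣-comm (toℕ i) (toℕ j))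
  ; irrefl = λ i → cong (λ a → not a ∧ (∣ toℕ i - toℕ i ∣ ≤ᵇ l ∸ 1)) (≡ᵇ-refl (toℕ i))
  }

allVecsOf : {X : Set} → List X → (k : ℕ) → List (Vec X k)
allVecsOf xs zero    = [] ∷ []
allVecsOf xs (suc k) = concatMap (λ x → map (x ∷_) (allVecsOf xs k)) xs

anyFin : {m : ℕ} → (Fin m → Bool) → Bool
anyFin p = any p (allFin _)

allFin' : {m : ℕ} → (Fin m → Bool) → Bool
allFin' p = all p (allFin _)

_=ᶠ_ : {m : ℕ} → Fin m → Fin m → Bool
i =ᶠ j = toℕ i ≡ᵇ toℕ j

_⇒ᵇ_ : Bool → Bool → Bool
a ⇒ᵇ b = not a ∨ b

_⇔ᵇ_ : Bool → Bool → Bool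
a ⇔ᵇ b = (a ⇒ᵇ b) ∧ (b ⇒ᵇ a)

-- Subgraphs of G (on Fin m), encoded uniquely as a pair (S , E):
-- S : vertex subset (characteristic vector),
-- E : symmetric edge matrix, every edge an edge of G with both ends in S.

SubCode : ℕ → Set
SubCode m = Vec Bool m × Vec (Vec Bool m) m

edgeOf : {m : ℕ} → SubCode m → Fin m → Fin m → Bool
edgeOf (S , E) i j = lookup (lookup E i) j

inS : {m : ℕ} → SubCode m → Fin m → Bool
inS (S , E) i = lookup S i

isSubgraph : {m : ℕ} → Graph m → SubCode m → Bool
isSubgraph G H =
  allFin' λ i → allFin' λ j →
    (edgeOf H i j ⇔ᵇ edgeOf H j i) ∧
    (edgeOf H i j ⇒ᵇ (adj G i j ∧ inS H i ∧ inS H j))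

isoWith : {n m : ℕ} → Graph n → SubCode m → Vec (Fin m) n → Bool
isoWith F H f =
  (allFin' λ a → inS H (lookup f a)) ∧
  (allFin' λ a → allFin' λ b → (lookup f a =ᶠ lookup f b) ⇒ᵇ (toℕ a ≡ᵇ toℕ b)) ∧
  (allFin' λ i → inS H i ⇒ᵇ (anyFin λ a → lookup f a =ᶠ i)) ∧
  (allFin' λ a → allFin' λ b → adj F a b ⇔ᵇ edgeOf H (lookup f a) (lookup f b))

isIso : {n m : ℕ} → Graph n → SubCode m → Bool
isIso {n} {m} F H = any (isoWith F H) (allVecsOf (allFin m) n)

allSubCodes : (m : ℕ) → List (SubCode m)
allSubCodes m =
  cartesianProduct (allVecsOf (true ∷ false ∷ []) m)
                   (allVecsOf (allVecsOf (true ∷ false ∷ []) m) m)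

Fdeg : {n m : ℕ} → Graph n → Graph m → Fin m → ℕ
Fdeg {n} {m} F G v =
  length (filter (λ H → Data.Bool.T? (isSubgraph G H ∧ isIso F H ∧ inS H v))
                 (allSubCodes m))

-- Write v = u + 1 and w = u + l. As v ≤ l, every neighbour of u other than v is a neighbour of v, so
-- the transposition (u v) maps each F-copy through u that avoids v onto an F-copy through v. Keeping
-- the copies that already contain v, this injects the copies through u into the copies through v,
-- and every copy in the image contains u or lacks the edge vw, because u and w are not adjacent.
-- The window {u + 1, …, u + l} is a clique containing v and w but not u. Sending an edge of F (there
-- is one, F having diameter 2) onto vw and the other n − 2 vertices of F onto any (n − 2)-subset of
-- the remaining l − 2 window vertices gives C(l − 2, n − 2) further copies through v, all distinct
-- and outside that image.

module Submission where

open import Defs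
open import Data.Nat using (ℕ; suc; _+_; _∸_; _≤_; _<_)
open import Data.Nat.Combinatorics using (_C_)
open import Data.Fin using (Fin; toℕ)
open import Relation.Binary.PropositionalEquality using (_≡_)

open import Data.Bool using (Bool; true; false; T; T?; _∧_; if_then_else_)
open import Data.Bool.ListAction using (all; any)
open import Data.Bool.Properties using (T-∧; T-≡; T-not-≡; ¬-not)
open import Data.Empty using (⊥-elim)
open import Data.Fin using (zero; suc; fromℕ; fromℕ<; lift)
import Data.Fin.Properties as Fin
open import Data.Fin.Properties using (toℕ-injective; lift-injective)
open import Data.Fin.Permutation using (Permutation′; transpose; _∘ₚ_; _⟨$⟩ʳ_; _⟨$⟩ˡ_; inverseˡ; inverseʳ; flip)
import Data.Fin.Permutation.Components as PC
open import Data.List using (List; []; _∷_; _++_; allFin; map; filter; length)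
open import Data.List.Properties using (length-++; length-++-sucʳ; length-map)
open import Data.List.Membership.Propositional using (_∈_; lose; find)
open import Data.List.Membership.Propositional.Properties
  using (∈-allFin; ∈-map⁺; ∈-map⁻; ∈-concatMap⁺; ∈-cartesianProduct⁺; ∈-∃++; ∈-++⁻; ∈-++⁺ˡ; ∈-++⁺ʳ; ∈-filter⁺; ∈-filter⁻)
open import Data.List.Relation.Binary.Disjoint.Propositional using (Disjoint)
open import Data.List.Relation.Binary.Subset.Propositional using (_⊆_)
open import Data.List.Relation.Unary.All as All using (All; []; _∷_)
import Data.List.Relation.Unary.All.Properties as All
open import Data.List.Relation.Unary.All.Properties using (all⁺; all⁻; tabulate⁺)
open import Data.List.Relation.Unary.AllPairs as AllPairs using (AllPairs; []; _∷_)
import Data.List.Relation.Unary.AllPairs.Properties as AllPairs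
open import Data.List.Relation.Unary.Any using (here; there; satisfied)
open import Data.List.Relation.Unary.Any.Properties using (any⁺; any⁻)
open import Data.List.Relation.Unary.Unique.Propositional using (Unique)
import Data.List.Relation.Unary.Unique.Propositional.Properties as Unique
open import Data.Nat using (zero; suc; z≤n; s≤s; _*_; _⊔_; ∣_-_∣)
open import Data.Nat.Combinatorics using (nCk+nC[k+1]≡[n+1]C[k+1])
import Data.Nat.Properties as ℕ
open import Data.Nat.Properties using (≡ᵇ⇒≡; ≡⇒≡ᵇ)
open import Data.Product using (∃; ∃₂; _×_; _,_; proj₁; proj₂)
open import Data.Sum using (_⊎_; inj₁; inj₂)
open import Data.Vec using (Vec; []; _∷_; lookup; tabulate)
open import Data.Vec.Properties using (lookup∘tabulate; tabulate∘lookup; tabulate-cong; ∷-injectiveˡ; ∷-injectiveʳ)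
open import Function using (id; _∘_; case_of_; _⇔_; mk⇔; Equivalence)
open import Function.Bundles using (Injection)
open import Function.Construct.Composition using (_⇔-∘_)
open import Function.Construct.Symmetry using (⇔-sym)
open import Function.Definitions using (Injective)
open import Function.Properties.Inverse using (↔⇒↣)
open import Relation.Binary.PropositionalEquality as ≡ using (refl; trans; cong; cong₂; subst; subst₂; _≗_; _≢_)
open import Relation.Nullary using (¬_; contradiction; yes; no)
open import Relation.Nullary.Decidable using (dec-true; dec-false)

open Equivalence using (to; from)

private
  variable
    n m : ℕ

-- Reflection of the Boolean encodings

T-⇒ᵇ : ∀ {a b} → T (a ⇒ᵇ b) ⇔ (T a → T b)
T-⇒ᵇ {true}  = mk⇔ (λ b _ → b) (λ f → f _)
T-⇒ᵇ {false} = mk⇔ (λ _ ()) (λ _ → _)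

T-⇔ᵇ : ∀ {a b} → T (a ⇔ᵇ b) ⇔ (a ≡ b)
T-⇔ᵇ {true}  {true}  = mk⇔ (λ _ → refl) (λ _ → _)
T-⇔ᵇ {true}  {false} = mk⇔ (λ ()) (λ ())
T-⇔ᵇ {false} {true}  = mk⇔ (λ ()) (λ ())
T-⇔ᵇ {false} {false} = mk⇔ (λ _ → refl) (λ _ → _)

T-=ᶠ : {i j : Fin m} → T (i =ᶠ j) ⇔ (i ≡ j)
T-=ᶠ {i = i} {j} = mk⇔ (toℕ-injective ∘ ≡ᵇ⇒≡ (toℕ i) (toℕ j)) (≡⇒≡ᵇ (toℕ i) (toℕ j) ∘ cong toℕ)

T-allFin' : {p : Fin m → Bool} → T (allFin' p) ⇔ (∀ i → T (p i))
T-allFin' {p = p} = mk⇔ (λ q i → All.lookup (all⁺ p _ q) (∈-allFin i)) (λ f → all⁻ p (tabulate⁺ f))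

T-anyFin : {p : Fin m → Bool} → T (anyFin p) ⇔ ∃ (T ∘ p)
T-anyFin {m} {p} = mk⇔ (satisfied ∘ any⁻ p (allFin m)) (λ (i , pi) → any⁺ p (lose (∈-allFin i) pi))

T-∧³ : ∀ {a b c} → T (a ∧ b ∧ c) ⇔ (T a × T b × T c)
T-∧³ {a} = mk⇔ (λ p → let (x , yz) = to (T-∧ {a}) p in x , to T-∧ yz)
               (λ (x , y , z) → from T-∧ (x , from T-∧ (y , z)))

T-injective : ∀ {a b} → T a ⇔ T b → a ≡ b
T-injective {true}  {true}  _ = refl
T-injective {true}  {false} p = ⊥-elim (to p _)
T-injective {false} {true}  p = ⊥-elim (from p _)
T-injective {false} {false} _ = refl

record IsSubgraph (G : Graph m) (H : SubCode m) : Set where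
  field
    edge-sym   : ∀ i j → edgeOf H i j ≡ edgeOf H j i
    edge-sound : ∀ i j → T (edgeOf H i j) → T (adj G i j) × T (inS H i) × T (inS H j)

Image : {A : Set} → (Fin n → A) → A → Set
Image f y = ∃ λ a → f a ≡ y

record IsoVia (F : Graph n) (H : SubCode m) (f : Fin n → Fin m) : Set where
  field
    image⇒inS  : ∀ a → T (inS H (f a))
    injective  : Injective _≡_ _≡_ f
    inS⇒image  : ∀ i → T (inS H i) → Image f i
    adj≡edgeOf : ∀ a b → adj F a b ≡ edgeOf H (f a) (f b)

IsCopy : Graph n → Graph m → SubCode m → Set
IsCopy F G H = IsSubgraph G H × ∃ (IsoVia F H)

adj-irrefl : (G : Graph m) {i : Fin m} → ¬ T (adj G i i)
adj-irrefl G {i} = subst T (irrefl G i)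

adj-sym : (G : Graph m) {i j : Fin m} → T (adj G i j) → T (adj G j i)
adj-sym G {i} {j} = subst T (Graph.sym G i j)

T-isSubgraph : {G : Graph m} {H : SubCode m} → T (isSubgraph G H) ⇔ IsSubgraph G H
T-isSubgraph {G = G} {H} = mk⇔
  (λ q → let clause i j = to T-∧ (to T-allFin' (to T-allFin' q i) j) in record
    { edge-sym   = λ i j → to T-⇔ᵇ (proj₁ (clause i j))
    ; edge-sound = λ i j → to T-∧³ ∘ to T-⇒ᵇ (proj₂ (clause i j)) })
  (λ s → from T-allFin' λ i → from T-allFin' λ j →
    from T-∧ (from T-⇔ᵇ (IsSubgraph.edge-sym s i j) , from T-⇒ᵇ (from T-∧³ ∘ IsSubgraph.edge-sound s i j)))

T-isoWith : {F : Graph n} {H : SubCode m} {f : Vec (Fin m) n} → T (isoWith F H f) ⇔ IsoVia F H (lookup f)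
T-isoWith {F = F} {H} {f} = mk⇔
  (λ q → let (c₁ , c₂ , c₃c₄) = to T-∧³ q ; (c₃ , c₄) = to T-∧ c₃c₄ in record
    { image⇒inS  = to T-allFin' c₁
    ; injective  = λ {a} {b} e → to T-=ᶠ (to T-⇒ᵇ (to T-allFin' (to T-allFin' c₂ a) b) (from T-=ᶠ e))
    ; inS⇒image  = λ i s → let (a , e) = to T-anyFin (to T-⇒ᵇ (to T-allFin' c₃ i) s) in a , to T-=ᶠ e
    ; adj≡edgeOf = λ a b → to T-⇔ᵇ (to T-allFin' (to T-allFin' c₄ a) b) })
  (λ iso → let open IsoVia iso in from T-∧³
    ( from T-allFin' image⇒inS
    , from T-allFin' (λ a → from (T-allFin' {p = λ b → (lookup f a =ᶠ lookup f b) ⇒ᵇ (a =ᶠ b)})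
                                  λ b → from T-⇒ᵇ (from T-=ᶠ ∘ injective ∘ to T-=ᶠ))
    , from T-∧
      ( from T-allFin' (λ i → from T-⇒ᵇ λ s → let (a , e) = inS⇒image i s in
                         from (T-anyFin {p = λ a → lookup f a =ᶠ i}) (a , from T-=ᶠ e))
      , from T-allFin' (λ a → from T-allFin' λ b → from T-⇔ᵇ (adj≡edgeOf a b)))))

∈-allVecsOf : {X : Set} {xs : List X} → (∀ x → x ∈ xs) → ∀ {k} (v : Vec X k) → v ∈ allVecsOf xs k
∈-allVecsOf xs-full []      = here refl
∈-allVecsOf xs-full (x ∷ v) = ∈-concatMap⁺ _ (lose (xs-full x) (∈-map⁺ (x ∷_) (∈-allVecsOf xs-full v)))

allVecsOf-unique : {X : Set} {xs : List X} → Unique xs → ∀ k → Unique (allVecsOf xs k)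
allVecsOf-unique xs-unique zero    = [] ∷ []
allVecsOf-unique {xs = xs} xs-unique (suc k) =
  Unique.concat⁺ (All.map⁺ (All.universal (λ _ → Unique.map⁺ ∷-injectiveʳ tails-unique) xs))
                 (AllPairs.map⁺ (AllPairs.map disjoint-heads xs-unique))
  where
  tails-unique : Unique (allVecsOf xs k)
  tails-unique = allVecsOf-unique xs-unique k
  disjoint-heads : ∀ {x y} → x ≢ y → Disjoint (map (x ∷_) (allVecsOf xs k)) (map (y ∷_) (allVecsOf xs k))
  disjoint-heads x≢y (p , q) with _ , _ , refl ← ∈-map⁻ (_ ∷_) p | _ , _ , e ← ∈-map⁻ (_ ∷_) q =
    x≢y (∷-injectiveˡ e)

bools : List Bool
bools = true ∷ false ∷ []

∈-bools : ∀ b → b ∈ bools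
∈-bools true  = here refl
∈-bools false = there (here refl)

bools-unique : Unique bools
bools-unique = ((λ ()) ∷ []) ∷ [] ∷ []

∈-allSubCodes : (H : SubCode m) → H ∈ allSubCodes m
∈-allSubCodes (S , E) = ∈-cartesianProduct⁺ (∈-allVecsOf ∈-bools S) (∈-allVecsOf (∈-allVecsOf ∈-bools) E)

allSubCodes-unique : ∀ m → Unique (allSubCodes m)
allSubCodes-unique m = Unique.cartesianProduct⁺ (allVecsOf-unique bools-unique m)
                                                (allVecsOf-unique (allVecsOf-unique bools-unique m) m)

IsoVia-cong : {F : Graph n} {H : SubCode m} {f g : Fin n → Fin m} → f ≗ g → IsoVia F H f → IsoVia F H g
IsoVia-cong {H = H} f≗g iso = record
  { image⇒inS  = λ a → subst (T ∘ inS H) (f≗g a) (image⇒inS a)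
  ; injective  = λ {a} {b} e → injective (trans (f≗g a) (trans e (≡.sym (f≗g b))))
  ; inS⇒image  = λ i s → let (a , e) = inS⇒image i s in a , trans (≡.sym (f≗g a)) e
  ; adj≡edgeOf = λ a b → trans (adj≡edgeOf a b) (cong₂ (edgeOf H) (f≗g a) (f≗g b))
  }
  where open IsoVia iso

T-isIso : {F : Graph n} {H : SubCode m} → T (isIso F H) ⇔ ∃ (IsoVia F H)
T-isIso {n} {m} {F} {H} = mk⇔
  (λ q → let (f , _ , iso) = find (any⁻ (isoWith F H) (allVecsOf (allFin m) n) q) in lookup f , to (T-isoWith {f = f}) iso)
  (λ (f , iso) → any⁺ (isoWith F H)
    (lose (∈-allVecsOf ∈-allFin (tabulate f))
          (from (T-isoWith {f = tabulate f}) (IsoVia-cong (≡.sym ∘ lookup∘tabulate f) iso))))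

isCopyAt : Graph n → Graph m → Fin m → SubCode m → Bool
isCopyAt F G x H = isSubgraph G H ∧ isIso F H ∧ inS H x

T-copyAt : {F : Graph n} {G : Graph m} {H : SubCode m} {x : Fin m} →
           T (isCopyAt F G x H) ⇔ (IsCopy F G H × T (inS H x))
T-copyAt = mk⇔ (λ q → let (s , i , x) = to T-∧³ q in (to T-isSubgraph s , to T-isIso i) , x)
               (λ ((s , i) , x) → from T-∧³ (from T-isSubgraph s , from T-isIso i , x))

-- Counting F-copies

unique-⊆⇒length-≤ : {X : Set} {xs ys : List X} → Unique xs → xs ⊆ ys → length xs ≤ length ys
unique-⊆⇒length-≤ {xs = []} _ _ = z≤n
unique-⊆⇒length-≤ {xs = x ∷ xs} (x∉xs ∷ xs-unique) xs⊆ys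
  with ys₁ , ys₂ , refl ← ∈-∃++ (xs⊆ys (here refl)) =
  ℕ.≤-trans (s≤s (unique-⊆⇒length-≤ xs-unique xs⊆ys₁++ys₂)) (ℕ.≤-reflexive (≡.sym (length-++-sucʳ ys₁ x ys₂)))
  where
  xs⊆ys₁++ys₂ : xs ⊆ ys₁ ++ ys₂
  xs⊆ys₁++ys₂ {y} y∈xs with ∈-++⁻ ys₁ (xs⊆ys (there y∈xs))
  ... | inj₁ y∈ys₁           = ∈-++⁺ˡ y∈ys₁
  ... | inj₂ (here refl)     = contradiction refl (All.lookup x∉xs y∈xs)
  ... | inj₂ (there y∈ys₂)   = ∈-++⁺ʳ ys₁ y∈ys₂

map-injectiveOn⁺ : {X Y : Set} {P : X → Set} {f : X → Y} {xs : List X} →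
                   (∀ {x y} → P x → P y → f x ≡ f y → x ≡ y) → All P xs → Unique xs → Unique (map f xs)
map-injectiveOn⁺ f-inj [] [] = []
map-injectiveOn⁺ f-inj (px ∷ pxs) (x∉xs ∷ xs-unique) =
  All.map⁺ (All.zipWith (λ (py , x≢y) → x≢y ∘ f-inj px py) (pxs , x∉xs)) ∷ map-injectiveOn⁺ f-inj pxs xs-unique

copiesAt : Graph n → Graph m → Fin m → List (SubCode m)
copiesAt F G x = filter (T? ∘ isCopyAt F G x) (allSubCodes _)

copiesAt-unique : (F : Graph n) (G : Graph m) (x : Fin m) → Unique (copiesAt F G x)
copiesAt-unique {m = m} F G x = Unique.filter⁺ (T? ∘ isCopyAt F G x) (allSubCodes-unique m)

∈-copiesAt⁻ : {F : Graph n} {G : Graph m} {x : Fin m} {H : SubCode m} →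
              H ∈ copiesAt F G x → IsCopy F G H × T (inS H x)
∈-copiesAt⁻ {m = m} {F = F} {G} {x} = to T-copyAt ∘ proj₂ ∘ ∈-filter⁻ (T? ∘ isCopyAt F G x) {xs = allSubCodes m}

Fdeg-≥ : {F : Graph n} {G : Graph m} {x : Fin m} {Hs : List (SubCode m)} → Unique Hs →
         All (λ H → IsCopy F G H × T (inS H x)) Hs → length Hs ≤ Fdeg F G x
Fdeg-≥ {F = F} {G} {x} Hs-unique Hs-copies = unique-⊆⇒length-≤ Hs-unique λ H∈Hs →
  ∈-filter⁺ (T? ∘ isCopyAt F G x) (∈-allSubCodes _) (from T-copyAt (All.lookup Hs-copies H∈Hs))

-- Relabelling a subgraph along a permutation

Vec-ext : {A : Set} {xs ys : Vec A n} → lookup xs ≗ lookup ys → xs ≡ ys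
Vec-ext {xs = xs} {ys} eq = trans (≡.sym (tabulate∘lookup xs)) (trans (tabulate-cong eq) (tabulate∘lookup ys))

SubCode-ext : {H H′ : SubCode m} → inS H ≗ inS H′ → (∀ i → edgeOf H i ≗ edgeOf H′ i) → H ≡ H′
SubCode-ext {H = S , E} {S′ , E′} inS-eq edgeOf-eq = cong₂ _,_ (Vec-ext inS-eq) (Vec-ext (Vec-ext ∘ edgeOf-eq))

relabel : Permutation′ m → SubCode m → SubCode m
relabel π (S , E) = tabulate (λ i → lookup S (π ⟨$⟩ˡ i)) ,
                    tabulate (λ i → tabulate (λ j → lookup (lookup E (π ⟨$⟩ˡ i)) (π ⟨$⟩ˡ j)))

inS-relabel : ∀ (π : Permutation′ m) H i → inS (relabel π H) i ≡ inS H (π ⟨$⟩ˡ i)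
inS-relabel π (S , E) = lookup∘tabulate _

edgeOf-relabel : ∀ (π : Permutation′ m) H i j → edgeOf (relabel π H) i j ≡ edgeOf H (π ⟨$⟩ˡ i) (π ⟨$⟩ˡ j)
edgeOf-relabel π (S , E) i j = trans (cong (λ r → lookup r j) (lookup∘tabulate _ i)) (lookup∘tabulate _ j)

relabel-flip : ∀ (π : Permutation′ m) H → relabel (flip π) (relabel π H) ≡ H
relabel-flip π H = SubCode-ext
  (λ i → trans (inS-relabel (flip π) (relabel π H) i) (trans (inS-relabel π H _) (cong (inS H) (inverseˡ π))))
  (λ i j → trans (edgeOf-relabel (flip π) (relabel π H) i j)
                 (trans (edgeOf-relabel π H _ _) (cong₂ (edgeOf H) (inverseˡ π) (inverseˡ π))))

relabel-injective : ∀ (π : Permutation′ m) → Injective _≡_ _≡_ (relabel π)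
relabel-injective π {H₁} {H₂} e =
  trans (≡.sym (relabel-flip π H₁)) (trans (cong (relabel (flip π)) e) (relabel-flip π H₂))

relabel-isSubgraph : {G : Graph m} (π : Permutation′ m) {H : SubCode m} → IsSubgraph G H →
                     (∀ i j → T (edgeOf H i j) → T (adj G (π ⟨$⟩ʳ i) (π ⟨$⟩ʳ j))) →
                     IsSubgraph G (relabel π H)
relabel-isSubgraph {G = G} π {H} H⊆G π-hom = record
  { edge-sym   = λ i j → trans (edgeOf-relabel π H i j)
                         (trans (edge-sym _ _) (≡.sym (edgeOf-relabel π H j i)))
  ; edge-sound = λ i j e → let e′ = subst T (edgeOf-relabel π H i j) e ; (_ , i∈H , j∈H) = edge-sound _ _ e′ in
      subst₂ (λ x y → T (adj G x y)) (inverseʳ π) (inverseʳ π) (π-hom _ _ e′) ,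
      subst T (≡.sym (inS-relabel π H i)) i∈H ,
      subst T (≡.sym (inS-relabel π H j)) j∈H
  }
  where open IsSubgraph H⊆G

relabel-isoVia : {F : Graph n} (π : Permutation′ m) {H : SubCode m} {f : Fin n → Fin m} →
                 IsoVia F H f → IsoVia F (relabel π H) ((π ⟨$⟩ʳ_) ∘ f)
relabel-isoVia π {H} {f} iso = record
  { image⇒inS  = λ a → subst T (≡.sym (trans (inS-relabel π H _) (cong (inS H) (inverseˡ π)))) (image⇒inS a)
  ; injective  = injective ∘ Injection.injective (↔⇒↣ π)
  ; inS⇒image  = λ i i∈πH → let (a , fa≡) = inS⇒image _ (subst T (inS-relabel π H i) i∈πH) in
                              a , trans (cong (π ⟨$⟩ʳ_) fa≡) (inverseʳ π)
  ; adj≡edgeOf = λ a b → trans (adj≡edgeOf a b) (≡.sym (trans (edgeOf-relabel π H _ _)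
                                                     (cong₂ (edgeOf H) (inverseˡ π) (inverseˡ π))))
  }
  where open IsoVia iso

transpose-matchˡ : (i j : Fin m) → PC.transpose i j i ≡ j
transpose-matchˡ i j rewrite dec-true (i Fin.≟ i) refl = refl

transpose-matchʳ : (i j : Fin m) → PC.transpose i j j ≡ i
transpose-matchʳ i j with j Fin.≟ i
... | yes j≡i = j≡i
... | no _ rewrite dec-true (j Fin.≟ j) refl = refl

transpose-other : {i j k : Fin m} → k ≢ i → k ≢ j → PC.transpose i j k ≡ k
transpose-other {i = i} {j} {k} k≢i k≢j rewrite dec-false (k Fin.≟ i) k≢i | dec-false (k Fin.≟ j) k≢j = refl

-- From copies through u to copies through v

module Shift (F : Graph n) (G : Graph m) {u v : Fin m}
             (N[u]⊆N[v] : ∀ y → T (adj G u y) → y ≢ v → T (adj G v y)) where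

  τ : Permutation′ m
  τ = transpose u v

  τ-off-v : ∀ x → x ≢ v → (x ≡ u × τ ⟨$⟩ʳ x ≡ v) ⊎ (x ≢ u × τ ⟨$⟩ʳ x ≡ x)
  τ-off-v x x≢v = case x Fin.≟ u of λ where
    (yes refl) → inj₁ (refl , transpose-matchˡ u v)
    (no x≢u)   → inj₂ (x≢u , transpose-other x≢u x≢v)

  τ-hom : ∀ x y → x ≢ v → y ≢ v → T (adj G x y) → T (adj G (τ ⟨$⟩ʳ x) (τ ⟨$⟩ʳ y))
  τ-hom x y x≢v y≢v xy with τ-off-v x x≢v | τ-off-v y y≢v
  ... | inj₁ (refl , _)  | inj₁ (refl , _)  = contradiction xy (adj-irrefl G)
  ... | inj₁ (refl , τx) | inj₂ (_ , τy)    rewrite τx | τy = N[u]⊆N[v] y xy y≢v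
  ... | inj₂ (_ , τx)    | inj₁ (refl , τy) rewrite τx | τy = adj-sym G (N[u]⊆N[v] x (adj-sym G xy) x≢v)
  ... | inj₂ (_ , τx)    | inj₂ (_ , τy)    rewrite τx | τy = xy

  v∈τH : ∀ {H} → T (inS H u) → T (inS (relabel τ H) v)
  v∈τH {H} = subst T (≡.sym (trans (inS-relabel τ H v) (cong (inS H) (transpose-matchˡ v u))))

  u∉τH : ∀ {H} → inS H v ≡ false → ¬ T (inS (relabel τ H) u)
  u∉τH {H} v∉H = subst T (trans (trans (inS-relabel τ H u) (cong (inS H) (transpose-matchʳ v u))) v∉H)

  τH-isCopy : ∀ {H} → IsCopy F G H → inS H v ≡ false → IsCopy F G (relabel τ H)
  τH-isCopy {H} (H⊆G , f , iso) v∉H =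
    relabel-isSubgraph τ {H} H⊆G τ-hom-on-H , (τ ⟨$⟩ʳ_) ∘ f , relabel-isoVia τ iso
    where
    ≢v : ∀ {x} → T (inS H x) → x ≢ v
    ≢v x∈H refl = subst T v∉H x∈H
    τ-hom-on-H : ∀ i j → T (edgeOf H i j) → T (adj G (τ ⟨$⟩ʳ i) (τ ⟨$⟩ʳ j))
    τ-hom-on-H i j e = let (ij , i∈H , j∈H) = IsSubgraph.edge-sound H⊆G i j e in τ-hom i j (≢v i∈H) (≢v j∈H) ij

  moveUToV : SubCode m → SubCode m
  moveUToV H = if inS H v then H else relabel τ H

  moveUToV-isCopy : ∀ {H} → IsCopy F G H → T (inS H u) → IsCopy F G (moveUToV H) × T (inS (moveUToV H) v)
  moveUToV-isCopy {H} H-copy u∈H with inS H v in v∈H?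
  ... | true  = H-copy , subst T (≡.sym v∈H?) _
  ... | false = τH-isCopy H-copy v∈H? , v∈τH {H} u∈H

  moveUToV-injective : ∀ {H₁ H₂} → T (inS H₁ u) → T (inS H₂ u) → moveUToV H₁ ≡ moveUToV H₂ → H₁ ≡ H₂
  moveUToV-injective {H₁} {H₂} u∈H₁ u∈H₂ e with inS H₁ v in v∈H₁? | inS H₂ v in v∈H₂?
  ... | true  | true  = e
  ... | false | false = relabel-injective τ e
  ... | true  | false = contradiction (subst (T ∘ (λ H → inS H u)) e u∈H₁) (u∉τH {H₂} v∈H₂?)
  ... | false | true  = contradiction (subst (T ∘ (λ H → inS H u)) (≡.sym e) u∈H₂) (u∉τH {H₁} v∈H₁?)

  moveUToV-edges : ∀ {H} → IsSubgraph G H → T (inS H u) →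
                   T (inS (moveUToV H) u) ⊎ (∀ {w} → w ≢ u → w ≢ v → T (edgeOf (moveUToV H) v w) → T (adj G u w))
  moveUToV-edges {H} H⊆G u∈H with inS H v
  ... | true  = inj₁ u∈H
  ... | false = inj₂ λ {w} w≢u w≢v vw →
    let uw = subst T (trans (edgeOf-relabel τ H v w) (cong₂ (edgeOf H) (transpose-matchˡ v u) (transpose-other w≢v w≢u))) vw
    in proj₁ (IsSubgraph.edge-sound H⊆G u w uw)

  moveUToV-≢ : ∀ {w H₀ H} → ¬ T (adj G u w) → IsSubgraph G H₀ → T (inS H₀ u) →
               IsSubgraph G H → T (edgeOf H v w) → ¬ T (inS H u) → moveUToV H₀ ≢ H
  moveUToV-≢ {w} {H₀} {H} u≁w H₀⊆G u∈H₀ H⊆G vw u∉H H₀↦H = case moveUToV-edges H₀⊆G u∈H₀ of λ where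
      (inj₁ u∈H₀↦)      → u∉H (subst (λ H′ → T (inS H′ u)) H₀↦H u∈H₀↦)
      (inj₂ edges-at-v) → u≁w (edges-at-v w≢u w≢v (subst (λ H′ → T (edgeOf H′ v w)) (≡.sym H₀↦H) vw))
    where
    vw-props : T (adj G v w) × T (inS H v) × T (inS H w)
    vw-props = IsSubgraph.edge-sound H⊆G v w vw
    w≢u : w ≢ u
    w≢u refl = u∉H (proj₂ (proj₂ vw-props))
    w≢v : w ≢ v
    w≢v refl = adj-irrefl G (proj₁ vw-props)

  Fdeg-shift : ∀ {w} → ¬ T (adj G u w) → {Hs : List (SubCode m)} → Unique Hs →
               All (λ H → IsCopy F G H × T (edgeOf H v w) × ¬ T (inS H u)) Hs →
               Fdeg F G u + length Hs ≤ Fdeg F G v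
  Fdeg-shift {w} u≁w {Hs} Hs-unique Hs-props =
    subst (_≤ Fdeg F G v) length-moved++Hs
      (Fdeg-≥ (Unique.++⁺ moved-unique Hs-unique moved-disjoint-Hs) (All.++⁺ moved-copies Hs-copies))
    where
    copies : List (SubCode m)
    copies = copiesAt F G u
    moved : List (SubCode m)
    moved = map moveUToV copies
    copies-props : All (λ H → IsCopy F G H × T (inS H u)) copies
    copies-props = All.tabulate ∈-copiesAt⁻
    moved-unique : Unique moved
    moved-unique = map-injectiveOn⁺ (λ (_ , u∈H₁) (_ , u∈H₂) → moveUToV-injective u∈H₁ u∈H₂)
                                    copies-props (copiesAt-unique F G u)
    moved-copies : All (λ H → IsCopy F G H × T (inS H v)) moved
    moved-copies = All.map⁺ (All.map (λ (H-copy , u∈H) → moveUToV-isCopy H-copy u∈H) copies-props)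
    Hs-copies : All (λ H → IsCopy F G H × T (inS H v)) Hs
    Hs-copies = All.map (λ ((H⊆G , iso) , vw , _) → (H⊆G , iso) , proj₁ (proj₂ (IsSubgraph.edge-sound H⊆G v w vw)))
                        Hs-props
    moved-disjoint-Hs : Disjoint moved Hs
    moved-disjoint-Hs (H∈moved , H∈Hs) =
      let (H₀ , H₀∈copies , H≡H₀↦) = ∈-map⁻ moveUToV H∈moved
          ((H₀⊆G , _) , u∈H₀) = All.lookup copies-props H₀∈copies
          ((H⊆G , _) , vw , u∉H) = All.lookup Hs-props H∈Hs
      in moveUToV-≢ u≁w H₀⊆G u∈H₀ H⊆G vw u∉H (≡.sym H≡H₀↦)
    length-moved++Hs : length (moved ++ Hs) ≡ Fdeg F G u + length Hs
    length-moved++Hs = trans (length-++ moved) (cong (_+ length Hs) (length-map moveUToV copies))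

-- Copies of F inside a clique

imageCode : Graph n → (Fin n → Fin m) → SubCode m
imageCode F e =
  tabulate (λ x → anyFin λ c → e c =ᶠ x) ,
  tabulate (λ x → tabulate λ y → anyFin λ c → anyFin λ d → (e c =ᶠ x) ∧ (e d =ᶠ y) ∧ adj F c d)

module _ (F : Graph n) (e : Fin n → Fin m) where

  T-inS-imageCode : ∀ {x} → T (inS (imageCode F e) x) ⇔ Image e x
  T-inS-imageCode {x} = mk⇔
    (λ s → let (c , ec) = to T-anyFin (subst T (lookup∘tabulate _ x) s) in c , to T-=ᶠ ec)
    (λ (c , ec) → subst T (≡.sym (lookup∘tabulate _ x)) (from (T-anyFin {p = λ c → e c =ᶠ x}) (c , from T-=ᶠ ec)))

  T-edgeOf-imageCode : ∀ {x y} → T (edgeOf (imageCode F e) x y) ⇔ (∃₂ λ c d → e c ≡ x × e d ≡ y × T (adj F c d))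
  T-edgeOf-imageCode {x} {y} = mk⇔
    (λ s → let (c , s′) = to T-anyFin (subst T edgeOf-eq s) ; (d , s″) = to T-anyFin s′
               (ec , ed , cd) = to T-∧³ s″ in
           c , d , to T-=ᶠ ec , to T-=ᶠ ed , cd)
    (λ (c , d , ec , ed , cd) → subst T (≡.sym edgeOf-eq)
      (from (T-anyFin {p = λ c → anyFin λ d → (e c =ᶠ x) ∧ (e d =ᶠ y) ∧ adj F c d})
        (c , from (T-anyFin {p = λ d → (e c =ᶠ x) ∧ (e d =ᶠ y) ∧ adj F c d})
          (d , from T-∧³ (from T-=ᶠ ec , from T-=ᶠ ed , cd)))))
    where
    edgeOf-eq : edgeOf (imageCode F e) x y ≡ (anyFin λ c → anyFin λ d → (e c =ᶠ x) ∧ (e d =ᶠ y) ∧ adj F c d)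
    edgeOf-eq = trans (cong (λ r → lookup r y) (lookup∘tabulate _ x)) (lookup∘tabulate _ y)

  imageCode-isSubgraph : {G : Graph m} → (∀ c d → T (adj F c d) → T (adj G (e c) (e d))) →
                         IsSubgraph G (imageCode F e)
  imageCode-isSubgraph {G} e-hom = record
    { edge-sym   = λ x y → T-injective (mk⇔ reverse reverse)
    ; edge-sound = λ x y → sound ∘ to T-edgeOf-imageCode
    }
    where
    sound : ∀ {x y} → (∃₂ λ c d → e c ≡ x × e d ≡ y × T (adj F c d)) →
            T (adj G x y) × T (inS (imageCode F e) x) × T (inS (imageCode F e) y)
    sound (c , d , refl , refl , cd) = e-hom c d cd , from T-inS-imageCode (c , refl) , from T-inS-imageCode (d , refl)
    reverse : ∀ {x y} → T (edgeOf (imageCode F e) x y) → T (edgeOf (imageCode F e) y x)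
    reverse s = let (c , d , ec , ed , cd) = to T-edgeOf-imageCode s in
      from T-edgeOf-imageCode (d , c , ed , ec , adj-sym F cd)

  imageCode-isoVia : Injective _≡_ _≡_ e → IsoVia F (imageCode F e) e
  imageCode-isoVia e-inj = record
    { image⇒inS  = λ c → from T-inS-imageCode (c , refl)
    ; injective  = e-inj
    ; inS⇒image  = λ _ → to T-inS-imageCode
    ; adj≡edgeOf = λ a b → T-injective (mk⇔
        (λ ab → from T-edgeOf-imageCode (a , b , refl , refl , ab))
        (λ s → let (c , d , ec , ed , cd) = to T-edgeOf-imageCode s in
               subst₂ (λ a b → T (adj F a b)) (e-inj ec) (e-inj ed) cd))
    }

imageCode-≢ : {F : Graph n} {e₁ e₂ : Fin n → Fin m} {y : Fin m} →
              ¬ (Image e₁ y ⇔ Image e₂ y) → imageCode F e₁ ≢ imageCode F e₂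
imageCode-≢ {F = F} {e₁} {e₂} {y} images-differ e = images-differ
  (T-inS-imageCode F e₂ ⇔-∘ subst (λ H → Image e₁ y ⇔ T (inS H y)) e (⇔-sym (T-inS-imageCode F e₁)))

ImagesDiffer : {k : ℕ} {A : Set} → (Fin k → A) → (Fin k → A) → Set
ImagesDiffer f g = ∃ λ y → ¬ (Image f y ⇔ Image g y)

ImagesDiffer-transport : {k k′ : ℕ} {A B : Set} {f g : Fin k → A} {f′ g′ : Fin k′ → B} (φ : A → B) →
                         (∀ {y} → Image f′ (φ y) ⇔ Image f y) → (∀ {y} → Image g′ (φ y) ⇔ Image g y) →
                         ImagesDiffer f g → ImagesDiffer f′ g′
ImagesDiffer-transport φ f-eq g-eq (y , images-differ) =
  φ y , λ eq → images-differ (g-eq ⇔-∘ (eq ⇔-∘ ⇔-sym f-eq))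

Image-∘-injective : {k : ℕ} {A B : Set} {c : A → B} {f : Fin k → A} {y : A} →
                    Injective _≡_ _≡_ c → Image (c ∘ f) (c y) ⇔ Image f y
Image-∘-injective c-inj = mk⇔ (λ (a , e) → a , c-inj e) (λ (a , e) → a , cong _ e)

Image-∘-surjective : {k k′ : ℕ} {A : Set} {σ : Fin k′ → Fin k} {f : Fin k → A} {y : A} →
                     (∀ i → Image σ i) → Image (f ∘ σ) y ⇔ Image f y
Image-∘-surjective {f = f} σ-surj =
  mk⇔ (λ (a , e) → _ , e) (λ (i , e) → let (a , σa≡i) = σ-surj i in a , trans (cong f σa≡i) e)

Image-lift-suc : {k M : ℕ} (j : ℕ) {t : Fin k → Fin M} {y : Fin (j + M)} →
                 Image (lift (suc j) t) (suc y) ⇔ Image (lift j t) y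
Image-lift-suc j = mk⇔ (λ { (suc i , e) → i , Fin.suc-injective e }) (λ (i , e) → suc i , cong suc e)

Image-suc-∘ : {k M : ℕ} {t : Fin k → Fin M} {y : Fin M} → Image (suc ∘ t) (suc y) ⇔ Image t y
Image-suc-∘ = mk⇔ (λ (i , e) → i , Fin.suc-injective e) (λ (i , e) → i , cong suc e)

lift-imagesDiffer : {k M : ℕ} (j : ℕ) {t₁ t₂ : Fin k → Fin M} →
                    ImagesDiffer t₁ t₂ → ImagesDiffer (lift j t₁) (lift j t₂)
lift-imagesDiffer zero    = id
lift-imagesDiffer (suc j) = ImagesDiffer-transport suc (Image-lift-suc j) (Image-lift-suc j) ∘ lift-imagesDiffer j

-- The strictly increasing maps, i.e. the k-subsets of Fin M, listed by Pascal's rule.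
combinations : ∀ M k → List (Fin k → Fin M)
combinations M       zero    = (λ ()) ∷ []
combinations zero    (suc k) = []
combinations (suc M) (suc k) = map (lift 1) (combinations M k) ++ map (suc ∘_) (combinations M (suc k))

length-combinations : ∀ M k → length (combinations M k) ≡ M C k
length-combinations M       zero    = refl
length-combinations zero    (suc k) = refl
length-combinations (suc M) (suc k) = begin
  length (map (lift 1) (combinations M k) ++ map (suc ∘_) (combinations M (suc k)))
    ≡⟨ length-++ (map (lift 1) (combinations M k)) ⟩
  length (map (lift 1) (combinations M k)) + length (map (suc ∘_) (combinations M (suc k)))
    ≡⟨ cong₂ _+_ (length-map (lift 1) (combinations M k)) (length-map (suc ∘_) (combinations M (suc k))) ⟩
  length (combinations M k) + length (combinations M (suc k))
    ≡⟨ cong₂ _+_ (length-combinations M k) (length-combinations M (suc k)) ⟩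
  M C k + M C suc k
    ≡⟨ nCk+nC[k+1]≡[n+1]C[k+1] M k ⟩
  suc M C suc k ∎
  where open ≡.≡-Reasoning

combinations-injective : ∀ M k → All (Injective _≡_ _≡_) (combinations M k)
combinations-injective M       zero    = (λ { {()} }) ∷ []
combinations-injective zero    (suc k) = []
combinations-injective (suc M) (suc k) = All.++⁺
  (All.map⁺ (All.map lift-injective′ (combinations-injective M k)))
  (All.map⁺ (All.map suc-∘-injective (combinations-injective M (suc k))))
  where
  lift-injective′ : {t : Fin k → Fin M} → Injective _≡_ _≡_ t → Injective _≡_ _≡_ (lift 1 t)
  lift-injective′ {t} t-inj = lift-injective t t-inj 1
  suc-∘-injective : {t : Fin (suc k) → Fin M} → Injective _≡_ _≡_ t → Injective _≡_ _≡_ (suc ∘ t)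
  suc-∘-injective t-inj = t-inj ∘ Fin.suc-injective

combinations-imagesDiffer : ∀ M k → AllPairs ImagesDiffer (combinations M k)
combinations-imagesDiffer M       zero    = [] ∷ []
combinations-imagesDiffer zero    (suc k) = []
combinations-imagesDiffer (suc M) (suc k) = AllPairs.++⁺
  (AllPairs.map⁺ (AllPairs.map (lift-imagesDiffer 1) (combinations-imagesDiffer M k)))
  (AllPairs.map⁺ (AllPairs.map (ImagesDiffer-transport suc Image-suc-∘ Image-suc-∘) (combinations-imagesDiffer M (suc k))))
  (All.map⁺ (All.universal (λ _ → All.map⁺ (All.universal (λ _ → zero-separates) _)) _))
  where
  zero-separates : {t₁ : Fin k → Fin M} {t₂ : Fin (suc k) → Fin M} → ImagesDiffer (lift 1 t₁) (suc ∘ t₂)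
  zero-separates = zero , λ eq → case to eq (zero , refl) of λ ()

module CliqueCopies {k L : ℕ} (F : Graph (suc (suc k))) {a₀ b₀ : Fin (suc (suc k))} (a₀b₀ : T (adj F a₀ b₀))
                    (G : Graph m) {c : Fin (suc (suc L)) → Fin m} (c-injective : Injective _≡_ _≡_ c)
                    (c-clique : ∀ i j → i ≢ j → T (adj G (c i) (c j))) where

  a₀≢b₀ : a₀ ≢ b₀
  a₀≢b₀ refl = adj-irrefl F a₀b₀

  b₁ : Fin (suc (suc k))
  b₁ = PC.transpose a₀ zero b₀

  σ : Permutation′ (suc (suc k))
  σ = transpose a₀ zero ∘ₚ transpose b₁ (suc zero)

  σ-a₀ : σ ⟨$⟩ʳ a₀ ≡ zero
  σ-a₀ = trans (cong (PC.transpose b₁ (suc zero)) (transpose-matchˡ a₀ zero)) (transpose-other zero≢b₁ λ ())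
    where
    zero≢b₁ : zero ≢ b₁
    zero≢b₁ e = a₀≢b₀ (Injection.injective (↔⇒↣ (transpose a₀ zero)) (trans (transpose-matchˡ a₀ zero) e))

  σ-b₀ : σ ⟨$⟩ʳ b₀ ≡ suc zero
  σ-b₀ = transpose-matchˡ b₁ (suc zero)

  -- σ puts a₀, b₀ at positions 0, 1, so embed t sends a₀b₀ onto c 0, c 1
  -- and the other vertices of F into c ∘ suc ∘ suc ∘ t.
  embed : (Fin k → Fin L) → Fin (suc (suc k)) → Fin m
  embed t = c ∘ lift 2 t ∘ (σ ⟨$⟩ʳ_)

  embed-injective : ∀ {t} → Injective _≡_ _≡_ t → Injective _≡_ _≡_ (embed t)
  embed-injective {t} t-inj = Injection.injective (↔⇒↣ σ) ∘ lift-injective t t-inj 2 ∘ c-injective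

  copy : (Fin k → Fin L) → SubCode m
  copy t = imageCode F (embed t)

  copy-isCopy : ∀ {t} → Injective _≡_ _≡_ t → IsCopy F G (copy t)
  copy-isCopy {t} t-inj = imageCode-isSubgraph F (embed t) embed-hom , embed t , imageCode-isoVia F (embed t) (embed-injective t-inj)
    where
    embed-hom : ∀ a b → T (adj F a b) → T (adj G (embed t a) (embed t b))
    embed-hom a b ab = c-clique _ _ λ e → adj-irrefl F (subst (λ x → T (adj F a x)) (≡.sym (embed-injective t-inj (cong c e))) ab)

  copy-edge : ∀ t → T (edgeOf (copy t) (c zero) (c (suc zero)))
  copy-edge t = from (T-edgeOf-imageCode F (embed t))
    (a₀ , b₀ , cong (c ∘ lift 2 t) σ-a₀ , cong (c ∘ lift 2 t) σ-b₀ , a₀b₀)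

  copy-⊆-clique : ∀ t {y} → T (inS (copy t) y) → Image c y
  copy-⊆-clique t y∈copy = let (a , e) = to (T-inS-imageCode F (embed t)) y∈copy in _ , e

  copy-≢ : ∀ {t₁ t₂} → ImagesDiffer t₁ t₂ → copy t₁ ≢ copy t₂
  copy-≢ = imageCode-≢ {F = F} ∘ proj₂
         ∘ ImagesDiffer-transport id σ-surjective σ-surjective
         ∘ ImagesDiffer-transport c (Image-∘-injective c-injective) (Image-∘-injective c-injective)
         ∘ lift-imagesDiffer 2
    where
    σ-surjective : ∀ {A : Set} {f : Fin (suc (suc k)) → A} {y} → Image (f ∘ (σ ⟨$⟩ʳ_)) y ⇔ Image f y
    σ-surjective = Image-∘-surjective λ i → σ ⟨$⟩ˡ i , inverseʳ σ

  copies : List (SubCode m)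
  copies = map copy (combinations L k)

  copies-unique : Unique copies
  copies-unique = AllPairs.map⁺ (AllPairs.map copy-≢ (combinations-imagesDiffer L k))

  length-copies : length copies ≡ L C k
  length-copies = trans (length-map copy (combinations L k)) (length-combinations L k)

  copies-props : All (λ H → IsCopy F G H × T (edgeOf H (c zero) (c (suc zero))) × (∀ {y} → T (inS H y) → Image c y)) copies
  copies-props = All.map⁺ (All.tabulate λ {t} t∈ →
    copy-isCopy (All.lookup (combinations-injective L k) t∈) , copy-edge t , copy-⊆-clique t)

-- The graph A_l

∣suc-m-n∣≤ : ∀ {a y d} → suc a ≤ d → ∣ a - y ∣ ≤ d → ∣ suc a - y ∣ ≤ d
∣suc-m-n∣≤ {a} {y} {d} suc-a≤d ∣a-y∣≤d with y ℕ.≤? a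
... | yes y≤a = begin
  ∣ suc a - y ∣ ≡⟨ ℕ.m≤n⇒∣n-m∣≡n∸m (ℕ.m≤n⇒m≤1+n y≤a) ⟩
  suc a ∸ y     ≤⟨ ℕ.m∸n≤m (suc a) y ⟩
  suc a         ≤⟨ suc-a≤d ⟩
  d             ∎
  where open ℕ.≤-Reasoning
... | no y≰a = begin
  ∣ suc a - y ∣ ≡⟨ ℕ.m≤n⇒∣m-n∣≡n∸m (ℕ.≰⇒> y≰a) ⟩
  y ∸ suc a     ≤⟨ ℕ.∸-monoʳ-≤ y (ℕ.n≤1+n a) ⟩
  y ∸ a         ≡⟨ ℕ.m≤n⇒∣m-n∣≡n∸m (ℕ.<⇒≤ (ℕ.≰⇒> y≰a)) ⟨
  ∣ a - y ∣     ≤⟨ ∣a-y∣≤d ⟩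
  d             ∎
  where open ℕ.≤-Reasoning

∣m+n-m+o∣≤ : ∀ i {x y d} → x ≤ d → y ≤ d → ∣ i + x - i + y ∣ ≤ d
∣m+n-m+o∣≤ i {x} {y} {d} x≤d y≤d = begin
  ∣ i + x - i + y ∣ ≡⟨ ℕ.∣m+n-m+o∣≡∣n-o∣ i x y ⟩
  ∣ x - y ∣         ≤⟨ ℕ.∣m-n∣≤m⊔n x y ⟩
  x ⊔ y             ≤⟨ ℕ.⊔-lub x≤d y≤d ⟩
  d                 ∎
  where open ℕ.≤-Reasoning

T-adj-A : ∀ l (i j : Fin (2 * l ∸ 1)) → T (adj (A l) i j) ⇔ (toℕ i ≢ toℕ j × ∣ toℕ i - toℕ j ∣ ≤ l ∸ 1)
T-adj-A l i j = mk⇔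
  (λ h → let (i≉j , close) = to T-∧ h in
         (λ e → subst T (to T-not-≡ i≉j) (≡⇒≡ᵇ _ _ e)) , ℕ.≤ᵇ⇒≤ _ _ close)
  (λ (i≢j , close) → from T-∧ (from T-not-≡ (¬-not (i≢j ∘ ≡ᵇ⇒≡ _ _ ∘ from T-≡)) , ℕ.≤⇒≤ᵇ close))

A-shift : ∀ {l} {u v : Fin (2 * l ∸ 1)} → toℕ v ≡ suc (toℕ u) → suc (toℕ u) ≤ l ∸ 1 →
          ∀ y → T (adj (A l) u y) → y ≢ v → T (adj (A l) v y)
A-shift {l} {u} {v} v≡suc-u suc-u≤ y uy y≢v = from (T-adj-A l v y)
  ( (λ e → y≢v (toℕ-injective (≡.sym e)))
  , subst (λ z → ∣ z - toℕ y ∣ ≤ l ∸ 1) (≡.sym v≡suc-u)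
      (∣suc-m-n∣≤ suc-u≤ (proj₂ (to (T-adj-A l u y) uy))))

A-far : ∀ {l} {u w : Fin (2 * l ∸ 1)} → toℕ w ≡ toℕ u + l → ¬ T (adj (A l) u w)
A-far {zero}   {u} {w} w≡u+l uw = proj₁ (to (T-adj-A 0 u w) uw) (≡.sym (trans w≡u+l (ℕ.+-identityʳ (toℕ u))))
A-far {suc l′} {u} {w} w≡u+l uw = ℕ.1+n≰n (subst (_≤ l′) u-w-distance (proj₂ (to (T-adj-A (suc l′) u w) uw)))
  where
  u-w-distance : ∣ toℕ u - toℕ w ∣ ≡ suc l′
  u-w-distance = trans (cong (∣ toℕ u -_∣) w≡u+l) (ℕ.∣m-m+n∣≡n (toℕ u) (suc l′))

module Window {L : ℕ} (u : Fin (2 * suc (suc L) ∸ 1)) (u-low : suc (toℕ u) ≤ suc L) where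

  window-bound : (x : Fin (suc (suc L))) → suc (toℕ u) + toℕ x < 2 * suc (suc L) ∸ 1
  window-bound x = begin-strict
    suc (toℕ u) + toℕ x     ≤⟨ ℕ.+-mono-≤ u-low (ℕ.≤-pred (Fin.toℕ<n x)) ⟩
    suc L + suc L           <⟨ ℕ.+-monoʳ-< (suc L) (ℕ.n<1+n (suc L)) ⟩
    suc L + suc (suc L)     ≡⟨ cong (suc L +_) (ℕ.+-identityʳ (suc (suc L))) ⟨
    2 * suc (suc L) ∸ 1     ∎
    where open ℕ.≤-Reasoning

  window : Fin (suc (suc L)) → Fin (2 * suc (suc L) ∸ 1)
  window x = fromℕ< (window-bound x)

  toℕ-window : ∀ x → toℕ (window x) ≡ suc (toℕ u) + toℕ x
  toℕ-window x = Fin.toℕ-fromℕ< (window-bound x)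

  window-injective : Injective _≡_ _≡_ window
  window-injective {x} {y} e =
    toℕ-injective (ℕ.+-cancelˡ-≡ (suc (toℕ u)) _ _ (trans (≡.sym (toℕ-window x)) (trans (cong toℕ e) (toℕ-window y))))

  window-clique : ∀ {x y} → x ≢ y → T (adj (A (suc (suc L))) (window x) (window y))
  window-clique {x} {y} x≢y = from (T-adj-A (suc (suc L)) (window x) (window y))
    ( x≢y ∘ window-injective ∘ toℕ-injective
    , subst₂ (λ i j → ∣ i - j ∣ ≤ suc L) (≡.sym (toℕ-window x)) (≡.sym (toℕ-window y))
        (∣m+n-m+o∣≤ (suc (toℕ u)) (ℕ.≤-pred (Fin.toℕ<n x)) (ℕ.≤-pred (Fin.toℕ<n y))))

  -- Swapping positions 1 and l − 1 gives clique 0 = u + 1 = v and clique 1 = u + l.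
  ρ : Permutation′ (suc (suc L))
  ρ = transpose (suc zero) (fromℕ (suc L))

  clique : Fin (suc (suc L)) → Fin (2 * suc (suc L) ∸ 1)
  clique = window ∘ (ρ ⟨$⟩ʳ_)

  clique-injective : Injective _≡_ _≡_ clique
  clique-injective = Injection.injective (↔⇒↣ ρ) ∘ window-injective

  clique-adj : ∀ i j → i ≢ j → T (adj (A (suc (suc L))) (clique i) (clique j))
  clique-adj i j i≢j = window-clique (i≢j ∘ Injection.injective (↔⇒↣ ρ))

  toℕ-clique-zero : toℕ (clique zero) ≡ suc (toℕ u)
  toℕ-clique-zero = begin
    toℕ (window (ρ ⟨$⟩ʳ zero)) ≡⟨ cong (toℕ ∘ window) (transpose-other {i = suc zero} {fromℕ (suc L)} (λ ()) (λ ())) ⟩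
    toℕ (window zero)          ≡⟨ toℕ-window zero ⟩
    suc (toℕ u) + 0            ≡⟨ ℕ.+-identityʳ (suc (toℕ u)) ⟩
    suc (toℕ u)                ∎
    where open ≡.≡-Reasoning

  toℕ-clique-one : toℕ (clique (suc zero)) ≡ toℕ u + suc (suc L)
  toℕ-clique-one = begin
    toℕ (window (ρ ⟨$⟩ʳ suc zero)) ≡⟨ cong (toℕ ∘ window) (transpose-matchˡ (suc zero) (fromℕ (suc L))) ⟩
    toℕ (window (fromℕ (suc L)))   ≡⟨ toℕ-window (fromℕ (suc L)) ⟩
    suc (toℕ u) + toℕ (fromℕ (suc L)) ≡⟨ cong (suc (toℕ u) +_) (Fin.toℕ-fromℕ (suc L)) ⟩
    suc (toℕ u) + suc L            ≡⟨ ℕ.+-suc (toℕ u) (suc L) ⟨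
    toℕ u + suc (suc L)            ∎
    where open ≡.≡-Reasoning

  u∉clique : ¬ Image clique u
  u∉clique (i , e) = ℕ.1+n≰n (begin
    suc (toℕ u)                        ≤⟨ ℕ.m≤m+n (suc (toℕ u)) _ ⟩
    suc (toℕ u) + toℕ (ρ ⟨$⟩ʳ i)       ≡⟨ toℕ-window (ρ ⟨$⟩ʳ i) ⟨
    toℕ (clique i)                     ≡⟨ cong toℕ e ⟩
    toℕ u                              ∎)
    where open ℕ.≤-Reasoning

diameter2⇒edge : {F : Graph n} → Diameter2 F → ∃₂ λ a b → T (adj F a b)
diameter2⇒edge (within2 , x , y , ¬within1) with within2 x y
... | _ , _ , here _         = contradiction (0 , z≤n , here x) ¬within1
... | _ , _ , step {w = z} xz _ = x , z , from T-≡ xz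

lemma2 : ∀ {n : ℕ} (F : Graph n) → Diameter2 F →
         ∀ (l : ℕ) → n < l →
         ∀ (u v : Fin (2 Data.Nat.* l ∸ 1)) →
         suc (toℕ u) ≤ l ∸ 1 → toℕ v ≡ suc (toℕ u) →
         Fdeg F (A l) u + (l ∸ 2) C (n ∸ 2) ≤ Fdeg F (A l) v
lemma2 {zero} F (_ , () , _)
lemma2 {suc zero} F F-diam with diameter2⇒edge F-diam
... | zero , zero , a₀a₀ = contradiction a₀a₀ (adj-irrefl F)
lemma2 {suc (suc k)} F F-diam zero          _ u v () _
lemma2 {suc (suc k)} F F-diam (suc zero)    _ u v () _
lemma2 {suc (suc k)} F F-diam (suc (suc L)) _ u v u-low v≡suc-u
  with _ , _ , a₀b₀ ← diameter2⇒edge F-diam =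
  subst (λ c → Fdeg F G u + c ≤ Fdeg F G v) length-copies
    (Fdeg-shift (A-far {suc (suc L)} {u} toℕ-clique-one) copies-unique copies-at-v)
  where
  G : Graph (2 * suc (suc L) ∸ 1)
  G = A (suc (suc L))
  open Window u u-low
  open CliqueCopies F a₀b₀ G clique-injective clique-adj
  open Shift F G {u} {v} (A-shift {suc (suc L)} {u} {v} v≡suc-u u-low)
  copies-at-v : All (λ H → IsCopy F G H × T (edgeOf H v (clique (suc zero))) × ¬ T (inS H u)) copies
  copies-at-v = All.map
    (λ {H} (H-copy , edge , ⊆clique) →
      H-copy , subst (λ x → T (edgeOf H x (clique (suc zero)))) clique-zero≡v edge , u∉clique ∘ ⊆clique)
    copies-props
    where
    clique-zero≡v : clique zero ≡ v
    clique-zero≡v = toℕ-injective (trans toℕ-clique-zero (≡.sym v≡suc-u))
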